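{- A first-order formula $A$ is unifiable in $\mathbf{CQC}$ if and only if there exists a ground substitution $\tau$ such that $\vdash_{\mathbf{CQC}} \tau(A)$ and $\tau(P(\bar s)) = \tau(P(\bar t))$ for all predicate symbols $P$ and all sequences of terms $\bar s, \bar t$.
   Context: Formulas are first-order formulas over countably many predicate symbols of each arity, with $\bot,\top,\neg,\wedge,\vee,\rightarrow,\forall,\exists$. A substitution $\sigma$ assigns to each predicate symbol $R$ a formula $\sigma(R)$ with at most as many free variables as the arity of $R$, and is extended by $\sigma(R(x_{i_1},\dots,x_{i_n})) = \sigma(R)(x_{i_1},\dots,x_{i_n})$ and commuting with $\bot,\top$, connectives and quantifiers. A ground substitution is one whose values lie in $\{\top,\bot\}$. $A$ is unifiable in $\mathbf{CQC}$ (classical first-order logic) iff $\vdash_{\mathbf{CQC}} \sigma(A)$ for some substitution $\sigma$. -}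

module Defs where

open import Data.Nat using (ℕ)
open import Data.Fin using (Fin)
open import Data.Vec using (Vec; lookup; map)
open import Data.List using (List; []; _∷_)
import Data.List as L
open import Data.Maybe using (Maybe; just; nothing; maybe)
open import Data.Product using (Σ; _×_)
open import Data.Sum using (_⊎_)
open import Relation.Binary.PropositionalEquality using (_≡_)
open import Data.List.Membership.Propositional using (_∈_)

-- First-order formulas over a set V of (free) variables, using a nested
-- (well-scoped de Bruijn) representation: a quantifier binds a fresh
-- variable, represented by 'nothing' in 'Maybe V'.
-- Terms are variables only (the language has predicate symbols only).
-- The predicate symbols of arity k are  R k i  for i : ℕ  (countably many
-- of each arity); an atom is  atom k i (x₁ … xₖ).
data Fm (V : Set) : Set where
  atom : (k i : ℕ) → Vec V k → Fm V
  ⊥'   : Fm V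
  ⊤'   : Fm V
  ¬'_  : Fm V → Fm V
  _∧'_ : Fm V → Fm V → Fm V
  _∨'_ : Fm V → Fm V → Fm V
  _⇒'_ : Fm V → Fm V → Fm V
  ∀'   : Fm (Maybe V) → Fm V
  ∃'   : Fm (Maybe V) → Fm V

ren : {V W : Set} → (V → W) → Fm V → Fm W
ren f (atom k i xs) = atom k i (map f xs)
ren f ⊥' = ⊥'
ren f ⊤' = ⊤'
ren f (¬' A) = ¬' ren f A
ren f (A ∧' B) = ren f A ∧' ren f B
ren f (A ∨' B) = ren f A ∨' ren f B
ren f (A ⇒' B) = ren f A ⇒' ren f B
ren f (∀' A) = ∀' (ren (Data.Maybe.map f) A)
ren f (∃' A) = ∃' (ren (Data.Maybe.map f) A)

wk : {V : Set} → Fm V → Fm (Maybe V)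
wk = ren just

inst : {V : Set} → V → Fm (Maybe V) → Fm V
inst t = ren (maybe (λ x → x) t)

infix 2 _⊢_
data _⊢_ {V : Set} (Γ : List (Fm V)) : Fm V → Set where
  hyp  : ∀ {A} → A ∈ Γ → Γ ⊢ A
  ⊤I   : Γ ⊢ ⊤'
  ⊥E   : ∀ {A} → Γ ⊢ ⊥' → Γ ⊢ A
  ¬I   : ∀ {A} → (A ∷ Γ) ⊢ ⊥' → Γ ⊢ ¬' A
  ¬E   : ∀ {A} → Γ ⊢ ¬' A → Γ ⊢ A → Γ ⊢ ⊥'
  RAA  : ∀ {A} → ((¬' A) ∷ Γ) ⊢ ⊥' → Γ ⊢ A
  ∧I   : ∀ {A B} → Γ ⊢ A → Γ ⊢ B → Γ ⊢ A ∧' B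
  ∧E₁  : ∀ {A B} → Γ ⊢ A ∧' B → Γ ⊢ A
  ∧E₂  : ∀ {A B} → Γ ⊢ A ∧' B → Γ ⊢ B
  ∨I₁  : ∀ {A B} → Γ ⊢ A → Γ ⊢ A ∨' B
  ∨I₂  : ∀ {A B} → Γ ⊢ B → Γ ⊢ A ∨' B
  ∨E   : ∀ {A B C} → Γ ⊢ A ∨' B → (A ∷ Γ) ⊢ C → (B ∷ Γ) ⊢ C → Γ ⊢ C
  ⇒I   : ∀ {A B} → (A ∷ Γ) ⊢ B → Γ ⊢ A ⇒' B
  ⇒E   : ∀ {A B} → Γ ⊢ A ⇒' B → Γ ⊢ A → Γ ⊢ B
  ∀I   : ∀ {A} → L.map wk Γ ⊢ A → Γ ⊢ ∀' A
  ∀E   : ∀ {A} → Γ ⊢ ∀' A → (t : V) → Γ ⊢ inst t A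
  ∃I   : ∀ {A} (t : V) → Γ ⊢ inst t A → Γ ⊢ ∃' A
  ∃E   : ∀ {A C} → Γ ⊢ ∃' A → (A ∷ L.map wk Γ) ⊢ wk C → Γ ⊢ C

Formula : Set
Formula = Fm ℕ

⊢CQC : Formula → Set
⊢CQC A = [] ⊢ A

-- A substitution assigns to the k-ary predicate symbol R k i a formula
-- whose free variables are among the k variables Fin k.
Subst : Set
Subst = (k i : ℕ) → Fm (Fin k)

applySub : {V : Set} → Subst → Fm V → Fm V
applySub σ (atom k i xs) = ren (lookup xs) (σ k i)
applySub σ ⊥' = ⊥'
applySub σ ⊤' = ⊤'
applySub σ (¬' A) = ¬' applySub σ A
applySub σ (A ∧' B) = applySub σ A ∧' applySub σ B
applySub σ (A ∨' B) = applySub σ A ∨' applySub σ B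
applySub σ (A ⇒' B) = applySub σ A ⇒' applySub σ B
applySub σ (∀' A) = ∀' (applySub σ A)
applySub σ (∃' A) = ∃' (applySub σ A)

Ground : Subst → Set
Ground σ = ∀ k i → (σ k i ≡ ⊤') ⊎ (σ k i ≡ ⊥')

Unifiable : Formula → Set
Unifiable A = Σ Subst λ σ → ⊢CQC (applySub σ A)

module Submission where

-- In the one-point model in which every atom is false, a formula's truth value ignores its
-- variables and its quantifiers.  If ⊢ σ(A), soundness makes σ(A) true there, so replacing
-- each σ(R) by its own truth value (⊤' or ⊥') yields a ground substitution τ with τ(A) true;
-- τ(R)(s̄) no longer depends on s̄.  Finally a formula built from ⊤' and ⊥' alone is
-- provable as soon as it is true: by induction it is proved when true and refuted when false.

open import Defs
open import Data.Bool using (Bool; true; false; T; not; _∧_; _∨_)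
open import Data.Bool.Properties using (T-∧; T-∨)
open import Data.Empty using (⊥; ⊥-elim)
open import Data.Fin using (Fin)
open import Data.List using (List; _∷_)
import Data.List as List
open import Data.List.Relation.Unary.All as All using (All; []; _∷_)
import Data.List.Relation.Unary.All.Properties as All
open import Data.List.Relation.Unary.Any using (here)
open import Data.Maybe using (Maybe; just; nothing; maybe)
import Data.Maybe as Maybe
import Data.Maybe.Properties as Maybe
open import Data.Nat using (ℕ)
open import Data.Product using (Σ; _×_; _,_; proj₁; proj₂)
open import Data.Sum using (_⊎_; inj₁; inj₂; [_,_])
open import Data.Vec using (Vec; lookup)
import Data.Vec.Properties as Vec
open import Function using (id; _∘_)
open import Function.Bundles using (_⇔_; mk⇔; Equivalence)
open import Relation.Binary.PropositionalEquality
  using (_≡_; refl; sym; trans; cong; cong₂; subst; _≗_; module ≡-Reasoning)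

private
  variable
    U V W : Set

ren-cong : {f g : V → W} → f ≗ g → ren f ≗ ren g
ren-cong f≗g (atom k i xs) = cong (atom k i) (Vec.map-cong f≗g xs)
ren-cong f≗g ⊥'            = refl
ren-cong f≗g ⊤'            = refl
ren-cong f≗g (¬' A)        = cong ¬'_ (ren-cong f≗g A)
ren-cong f≗g (A ∧' B)      = cong₂ _∧'_ (ren-cong f≗g A) (ren-cong f≗g B)
ren-cong f≗g (A ∨' B)      = cong₂ _∨'_ (ren-cong f≗g A) (ren-cong f≗g B)
ren-cong f≗g (A ⇒' B)      = cong₂ _⇒'_ (ren-cong f≗g A) (ren-cong f≗g B)
ren-cong f≗g (∀' A)        = cong ∀' (ren-cong (Maybe.map-cong f≗g) A)
ren-cong f≗g (∃' A)        = cong ∃' (ren-cong (Maybe.map-cong f≗g) A)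

ren-id : ren id ≗ id {A = Fm V}
ren-id (atom k i xs) = cong (atom k i) (Vec.map-id xs)
ren-id ⊥'            = refl
ren-id ⊤'            = refl
ren-id (¬' A)        = cong ¬'_ (ren-id A)
ren-id (A ∧' B)      = cong₂ _∧'_ (ren-id A) (ren-id B)
ren-id (A ∨' B)      = cong₂ _∨'_ (ren-id A) (ren-id B)
ren-id (A ⇒' B)      = cong₂ _⇒'_ (ren-id A) (ren-id B)
ren-id (∀' A)        = cong ∀' (trans (ren-cong Maybe.map-id A) (ren-id A))
ren-id (∃' A)        = cong ∃' (trans (ren-cong Maybe.map-id A) (ren-id A))

ren-∘ : (g : V → W) (f : U → V) → ren g ∘ ren f ≗ ren (g ∘ f)
ren-∘ g f (atom k i xs) = cong (atom k i) (sym (Vec.map-∘ g f xs))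
ren-∘ g f ⊥'            = refl
ren-∘ g f ⊤'            = refl
ren-∘ g f (¬' A)        = cong ¬'_ (ren-∘ g f A)
ren-∘ g f (A ∧' B)      = cong₂ _∧'_ (ren-∘ g f A) (ren-∘ g f B)
ren-∘ g f (A ∨' B)      = cong₂ _∨'_ (ren-∘ g f A) (ren-∘ g f B)
ren-∘ g f (A ⇒' B)      = cong₂ _⇒'_ (ren-∘ g f A) (ren-∘ g f B)
ren-∘ g f (∀' A)        =
  cong ∀' (trans (ren-∘ _ _ A) (ren-cong (sym ∘ Maybe.map-∘) A))
ren-∘ g f (∃' A)        =
  cong ∃' (trans (ren-∘ _ _ A) (ren-cong (sym ∘ Maybe.map-∘) A))

eval : Fm V → Bool
eval (atom k i xs) = false
eval ⊥'            = false
eval ⊤'            = true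
eval (¬' A)        = not (eval A)
eval (A ∧' B)      = eval A ∧ eval B
eval (A ∨' B)      = eval A ∨ eval B
eval (A ⇒' B)      = not (eval A) ∨ eval B
eval (∀' A)        = eval A
eval (∃' A)        = eval A

eval-ren : (f : V → W) (A : Fm V) → eval (ren f A) ≡ eval A
eval-ren f (atom k i xs) = refl
eval-ren f ⊥'            = refl
eval-ren f ⊤'            = refl
eval-ren f (¬' A)        = cong not (eval-ren f A)
eval-ren f (A ∧' B)      = cong₂ _∧_ (eval-ren f A) (eval-ren f B)
eval-ren f (A ∨' B)      = cong₂ _∨_ (eval-ren f A) (eval-ren f B)
eval-ren f (A ⇒' B)      = cong₂ (λ a b → not a ∨ b) (eval-ren f A) (eval-ren f B)
eval-ren f (∀' A)        = eval-ren _ A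
eval-ren f (∃' A)        = eval-ren _ A

T-not⁺ : {b : Bool} → (T b → ⊥) → T (not b)
T-not⁺ {false} _  = _
T-not⁺ {true}  ¬b = ¬b _

T-not⁻ : {b : Bool} → T (not b) → T b → ⊥
T-not⁻ {false} _ ()

T-stable : {b : Bool} → (T (not b) → ⊥) → T b
T-stable {false} ¬¬b = ¬¬b _
T-stable {true}  _   = _

T-⇒⁺ : {a b : Bool} → (T a → T b) → T (not a ∨ b)
T-⇒⁺ {false} _   = _
T-⇒⁺ {true}  a⇒b = a⇒b _

T-⇒⁻ : {a b : Bool} → T (not a ∨ b) → T a → T b
T-⇒⁻ {true} b _ = b

True : List (Fm V) → Set
True = All (T ∘ eval)

True-wk : {Γ : List (Fm V)} → True Γ → True (List.map wk Γ)
True-wk = All.map⁺ ∘ All.map (λ {C} → subst T (sym (eval-ren just C)))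

soundness : {Γ : List (Fm V)} {A : Fm V} → Γ ⊢ A → True Γ → T (eval A)
soundness (hyp A∈Γ)   γ = All.lookup γ A∈Γ
soundness ⊤I          γ = _
soundness (⊥E d)      γ = ⊥-elim (soundness d γ)
soundness (¬I d)      γ = T-not⁺ (λ a → soundness d (a ∷ γ))
soundness (¬E d e)    γ = T-not⁻ (soundness d γ) (soundness e γ)
soundness (RAA d)     γ = T-stable (λ ¬a → soundness d (¬a ∷ γ))
soundness (∧I d e)    γ = Equivalence.from T-∧ (soundness d γ , soundness e γ)
soundness (∧E₁ d)     γ = proj₁ (Equivalence.to T-∧ (soundness d γ))
soundness (∧E₂ d)     γ = proj₂ (Equivalence.to T-∧ (soundness d γ))
soundness (∨I₁ d)     γ = Equivalence.from T-∨ (inj₁ (soundness d γ))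
soundness (∨I₂ d)     γ = Equivalence.from T-∨ (inj₂ (soundness d γ))
soundness (∨E d e f)  γ =
  [ (λ a → soundness e (a ∷ γ)) , (λ b → soundness f (b ∷ γ)) ]
    (Equivalence.to T-∨ (soundness d γ))
soundness (⇒I d)      γ = T-⇒⁺ (λ a → soundness d (a ∷ γ))
soundness (⇒E d e)    γ = T-⇒⁻ (soundness d γ) (soundness e γ)
soundness (∀I d)      γ = soundness d (True-wk γ)
soundness (∀E {A} d t) γ = subst T (sym (eval-ren _ A)) (soundness d γ)
soundness (∃I {A} t d) γ = subst T (eval-ren _ A) (soundness d γ)
soundness (∃E {C = C} d e) γ =
  subst T (eval-ren just C) (soundness e (soundness d γ ∷ True-wk γ))

data AtomFree {V : Set} : Fm V → Set where
  ⊥' : AtomFree ⊥'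
  ⊤' : AtomFree ⊤'
  ¬'_ : ∀ {A} → AtomFree A → AtomFree (¬' A)
  _∧'_ : ∀ {A B} → AtomFree A → AtomFree B → AtomFree (A ∧' B)
  _∨'_ : ∀ {A B} → AtomFree A → AtomFree B → AtomFree (A ∨' B)
  _⇒'_ : ∀ {A B} → AtomFree A → AtomFree B → AtomFree (A ⇒' B)
  ∀' : ∀ {A} → AtomFree A → AtomFree (∀' A)
  ∃' : ∀ {A} → AtomFree A → AtomFree (∃' A)

Provable : Fm V → Set
Provable A = ∀ {Γ} → Γ ⊢ A

signed : Bool → Fm V → Fm V
signed true  A = A
signed false A = ¬' A

assumption : {Γ : List (Fm V)} {A : Fm V} → (A ∷ Γ) ⊢ A
assumption = hyp (here refl)

¬-signed : ∀ {a} {A : Fm V} → Provable (signed a A) → Provable (signed (not a) (¬' A))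
¬-signed {a = true}  p = ¬I (¬E assumption p)
¬-signed {a = false} p = p

∧-signed : ∀ {a b} {A B : Fm V} →
  Provable (signed a A) → Provable (signed b B) → Provable (signed (a ∧ b) (A ∧' B))
∧-signed {a = true}  {true}  p q = ∧I p q
∧-signed {a = true}  {false} p q = ¬I (¬E q (∧E₂ assumption))
∧-signed {a = false}         p q = ¬I (¬E p (∧E₁ assumption))

∨-signed : ∀ {a b} {A B : Fm V} →
  Provable (signed a A) → Provable (signed b B) → Provable (signed (a ∨ b) (A ∨' B))
∨-signed {a = true}          p q = ∨I₁ p
∨-signed {a = false} {true}  p q = ∨I₂ q
∨-signed {a = false} {false} p q =
  ¬I (∨E assumption (¬E p assumption) (¬E q assumption))

⇒-signed : ∀ {a b} {A B : Fm V} →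
  Provable (signed a A) → Provable (signed b B) → Provable (signed (not a ∨ b) (A ⇒' B))
⇒-signed {a = false}         p q = ⇒I (⊥E (¬E p assumption))
⇒-signed {a = true}  {true}  p q = ⇒I q
⇒-signed {a = true}  {false} p q = ¬I (¬E q (⇒E assumption p))

∀-signed : ∀ {a} {A : Fm (Maybe V)} (w : V) →
  Provable (signed a A) → Provable (signed a (inst w A)) → Provable (signed a (∀' A))
∀-signed {a = true}  w p q = ∀I p
∀-signed {a = false} w p q = ¬I (¬E q (∀E assumption w))

∃-signed : ∀ {a} {A : Fm (Maybe V)} (w : V) →
  Provable (signed a A) → Provable (signed a (inst w A)) → Provable (signed a (∃' A))
∃-signed {a = true}  w p q = ∃I w q
∃-signed {a = false} w p q = ¬I (∃E assumption (¬E p assumption))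

-- Renamings are carried along because instantiating a quantifier is itself a renaming;
-- the inhabitant w of W is the witness for ∀-elimination and ∃-introduction.
atomFree-signed : {C : Fm V} → AtomFree C →
  (f : V → W) (w : W) → Provable (signed (eval C) (ren f C))
atomFree-signed-inst : {C : Fm (Maybe V)} → AtomFree C → (f : V → W) (w : W) →
  Provable (signed (eval C) (inst w (ren (Maybe.map f) C)))

atomFree-signed ⊥'       f w = ¬I assumption
atomFree-signed ⊤'       f w = ⊤I
atomFree-signed (¬' a)   f w = ¬-signed (atomFree-signed a f w)
atomFree-signed (a ∧' b) f w = ∧-signed (atomFree-signed a f w) (atomFree-signed b f w)
atomFree-signed (a ∨' b) f w = ∨-signed (atomFree-signed a f w) (atomFree-signed b f w)
atomFree-signed (a ⇒' b) f w = ⇒-signed (atomFree-signed a f w) (atomFree-signed b f w)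
atomFree-signed (∀' a)   f w =
  ∀-signed w (atomFree-signed a (Maybe.map f) nothing) (atomFree-signed-inst a f w)
atomFree-signed (∃' a)   f w =
  ∃-signed w (atomFree-signed a (Maybe.map f) nothing) (atomFree-signed-inst a f w)

atomFree-signed-inst {C = C} a f w =
  subst (λ X → Provable (signed (eval C) X))
    (sym (ren-∘ (maybe id w) (Maybe.map f) C))
    (atomFree-signed a (maybe id w ∘ Maybe.map f) w)

atomFree-complete : {C : Fm V} → AtomFree C → V → T (eval C) → Provable C
atomFree-complete {C = C} a w C-true {Γ} =
  subst (Γ ⊢_) (ren-id C) (signed-true C-true (atomFree-signed a id w))
  where
  signed-true : ∀ {b} {A : Fm _} → T b → Provable (signed b A) → Provable A
  signed-true {b = true} _ p = p

fromBool : Bool → Fm V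
fromBool true  = ⊤'
fromBool false = ⊥'

fromBool-ground : (b : Bool) → (fromBool {V} b ≡ ⊤') ⊎ (fromBool {V} b ≡ ⊥')
fromBool-ground true  = inj₁ refl
fromBool-ground false = inj₂ refl

eval-fromBool : (b : Bool) → eval (fromBool {V} b) ≡ b
eval-fromBool true  = refl
eval-fromBool false = refl

applySub-ground-atom : {τ : Subst} → Ground τ →
  ∀ k i (xs ys : Vec V k) → applySub τ (atom k i xs) ≡ applySub τ (atom k i ys)
applySub-ground-atom {τ = τ} τ-ground k i xs ys with τ k i | τ-ground k i
... | _ | inj₁ refl = refl
... | _ | inj₂ refl = refl

atomFree-applySub-ground : {τ : Subst} → Ground τ → (A : Fm V) → AtomFree (applySub τ A)
atomFree-applySub-ground {τ = τ} τ-ground (atom k i xs) with τ k i | τ-ground k i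
... | _ | inj₁ refl = ⊤'
... | _ | inj₂ refl = ⊥'
atomFree-applySub-ground τ-ground ⊥'       = ⊥'
atomFree-applySub-ground τ-ground ⊤'       = ⊤'
atomFree-applySub-ground τ-ground (¬' A)   = ¬' atomFree-applySub-ground τ-ground A
atomFree-applySub-ground τ-ground (A ∧' B) =
  atomFree-applySub-ground τ-ground A ∧' atomFree-applySub-ground τ-ground B
atomFree-applySub-ground τ-ground (A ∨' B) =
  atomFree-applySub-ground τ-ground A ∨' atomFree-applySub-ground τ-ground B
atomFree-applySub-ground τ-ground (A ⇒' B) =
  atomFree-applySub-ground τ-ground A ⇒' atomFree-applySub-ground τ-ground B
atomFree-applySub-ground τ-ground (∀' A)   = ∀' (atomFree-applySub-ground τ-ground A)
atomFree-applySub-ground τ-ground (∃' A)   = ∃' (atomFree-applySub-ground τ-ground A)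

collapse : Subst → Subst
collapse σ k i = fromBool (eval (σ k i))

collapse-ground : (σ : Subst) → Ground (collapse σ)
collapse-ground σ k i = fromBool-ground (eval (σ k i))

eval-collapse : (σ : Subst) (A : Fm V) → eval (applySub (collapse σ) A) ≡ eval (applySub σ A)
eval-collapse σ (atom k i xs) = begin
  eval (ren (lookup xs) (fromBool b))  ≡⟨ eval-ren (lookup xs) (fromBool b) ⟩
  eval (fromBool {Fin k} b)            ≡⟨ eval-fromBool b ⟩
  eval (σ k i)                         ≡⟨ eval-ren (lookup xs) (σ k i) ⟨
  eval (ren (lookup xs) (σ k i))       ∎
  where
  open ≡-Reasoning
  b : Bool
  b = eval (σ k i)
eval-collapse σ ⊥'       = refl
eval-collapse σ ⊤'       = refl
eval-collapse σ (¬' A)   = cong not (eval-collapse σ A)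
eval-collapse σ (A ∧' B) = cong₂ _∧_ (eval-collapse σ A) (eval-collapse σ B)
eval-collapse σ (A ∨' B) = cong₂ _∨_ (eval-collapse σ A) (eval-collapse σ B)
eval-collapse σ (A ⇒' B) = cong₂ (λ a b → not a ∨ b) (eval-collapse σ A) (eval-collapse σ B)
eval-collapse σ (∀' A)   = eval-collapse σ A
eval-collapse σ (∃' A)   = eval-collapse σ A

⊢CQC-collapse : (σ : Subst) (A : Formula) →
  ⊢CQC (applySub σ A) → ⊢CQC (applySub (collapse σ) A)
⊢CQC-collapse σ A ⊢σA =
  atomFree-complete (atomFree-applySub-ground (collapse-ground σ) A) 0
    (subst T (sym (eval-collapse σ A)) (soundness ⊢σA []))

mainTheorem17 : (A : Formula) →
    Unifiable A ⇔
      Σ Subst (λ τ → Ground τ × ⊢CQC (applySub τ A) ×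
        ((k i : ℕ) (s t : Vec ℕ k) →
          applySub τ (atom k i s) ≡ applySub τ (atom k i t)))
mainTheorem17 A = mk⇔
  (λ (σ , ⊢σA) → collapse σ , collapse-ground σ , ⊢CQC-collapse σ A ⊢σA ,
                 applySub-ground-atom (collapse-ground σ))
  (λ (τ , _ , ⊢τA , _) → τ , ⊢τA)
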